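{- There exist integers $n\ge 2$ and $0\le k\le n$ such that $\gamma(n,k)\neq\delta(n,k)$.
   Context: For integers $n\ge 2$, $0\le k\le n$, a $\Lambda_n^k$-matrix is an $n\times n$ matrix with entries in $\{0,1\}$ having exactly $k$ entries equal to $1$ in each row and in each column; $\Lambda_n^k$ denotes the set of all such matrices. For a binary $n\times m$ matrix $A=(a_{ij})$, let $r(A)=\langle x_1,\dots,x_n\rangle$ with $x_i=\sum_{j=1}^m a_{ij}2^{m-j}$ (the integer whose binary notation is the $i$-th row) and $c(A)=\langle y_1,\dots,y_m\rangle$ with $y_j=\sum_{i=1}^n a_{ij}2^{n-i}$ (the integer whose binary notation is the $j$-th column). Let $\mathfrak{C}_{n\times m}$ be the set of binary $n\times m$ matrices with $x_1\le x_2\le\cdots\le x_n$ and $y_1\le\cdots\le y_m$, and $\mathfrak{D}_{n\times m}$ the set of binary $n\times m$ matrices with $x_1\ge\cdots\ge x_n$ and $y_1\ge\cdots\ge y_m$. Define $\Gamma_n^k=\mathfrak{C}_{n\times n}\cap\Lambda_n^k$, $\Delta_n^k=\mathfrak{D}_{n\times n}\cap\Lambda_n^k$, $\gamma(n,k)=|\Gamma_n^k|$, $\delta(n,k)=|\Delta_n^k|$. -}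

module Defs where

open import Data.Bool using (Bool; true; false; if_then_else_)
open import Data.Nat using (ℕ; zero; suc; _+_; _*_; _∸_; _^_; _≤_; _≥_; _≤?_; _≟_)
open import Data.Fin using (Fin; toℕ; zero; suc)
open import Data.List using (List; []; _∷_; map; concatMap; length; filter)
open import Data.Product using (_×_; _,_)
open import Relation.Nullary using (Dec; yes; no; _×-dec_)
open import Relation.Unary using (Decidable)
open import Relation.Binary.PropositionalEquality using (_≡_)

Matrix : ℕ → ℕ → Set
Matrix n m = Fin n → Fin m → Bool

bit : Bool → ℕ
bit true  = 1
bit false = 0

sumFin : (n : ℕ) → (Fin n → ℕ) → ℕ
sumFin zero    f = 0
sumFin (suc n) f = f zero + sumFin n (λ i → f (suc i))

-- x_i = Σ_j a_ij 2^(m-j) with 1-based j; with 0-based j this is 2^(m-1-j).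
rowVal : ∀ {n m} → Matrix n m → Fin n → ℕ
rowVal {n} {m} A i = sumFin m (λ j → bit (A i j) * 2 ^ (m ∸ suc (toℕ j)))

-- y_j = Σ_i a_ij 2^(n-i) with 1-based i.
colVal : ∀ {n m} → Matrix n m → Fin m → ℕ
colVal {n} {m} A j = sumFin n (λ i → bit (A i j) * 2 ^ (n ∸ suc (toℕ i)))

rowOnes : ∀ {n m} → Matrix n m → Fin n → ℕ
rowOnes {n} {m} A i = sumFin m (λ j → bit (A i j))

colOnes : ∀ {n m} → Matrix n m → Fin m → ℕ
colOnes {n} {m} A j = sumFin n (λ i → bit (A i j))

IsΛ : (n k : ℕ) → Matrix n n → Set
IsΛ n k A = (∀ i → rowOnes A i ≡ k) × (∀ j → colOnes A j ≡ k)

NonDecr : (p : ℕ) → (Fin p → ℕ) → Set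
NonDecr zero          f = Data.Unit.⊤ where import Data.Unit
NonDecr (suc zero)    f = Data.Unit.⊤ where import Data.Unit
NonDecr (suc (suc p)) f = (f zero ≤ f (suc zero)) × NonDecr (suc p) (λ i → f (suc i))

NonIncr : (p : ℕ) → (Fin p → ℕ) → Set
NonIncr zero          f = Data.Unit.⊤ where import Data.Unit
NonIncr (suc zero)    f = Data.Unit.⊤ where import Data.Unit
NonIncr (suc (suc p)) f = (f zero ≥ f (suc zero)) × NonIncr (suc p) (λ i → f (suc i))

InC : (n m : ℕ) → Matrix n m → Set
InC n m A = NonDecr n (rowVal A) × NonDecr m (colVal A)

InD : (n m : ℕ) → Matrix n m → Set
InD n m A = NonIncr n (rowVal A) × NonIncr m (colVal A)

allFuns : ∀ {a} {A : Set a} → List A → (p : ℕ) → List (Fin p → A)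
allFuns xs zero    = (λ ()) ∷ []
allFuns xs (suc p) =
  concatMap (λ x → map (λ f → λ { zero → x ; (suc i) → f i }) (allFuns xs p)) xs

allMatrices : (n m : ℕ) → List (Matrix n m)
allMatrices n m = allFuns (allFuns (true ∷ false ∷ []) m) n

allFin? : (p : ℕ) → (P : Fin p → Set) → (∀ i → Dec (P i)) → Dec (∀ i → P i)
allFin? zero P d = yes (λ ())
allFin? (suc p) P d with d zero | allFin? p (λ i → P (suc i)) (λ i → d (suc i))
... | yes h | yes t = yes (λ { zero → h ; (suc i) → t i })
... | no ¬h | _     = no (λ f → ¬h (f zero))
... | _     | no ¬t = no (λ f → ¬t (λ i → f (suc i)))

nonDecr? : (p : ℕ) → (f : Fin p → ℕ) → Dec (NonDecr p f)
nonDecr? zero f = yes _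
nonDecr? (suc zero) f = yes _
nonDecr? (suc (suc p)) f = (f zero ≤? f (suc zero)) ×-dec nonDecr? (suc p) (λ i → f (suc i))

nonIncr? : (p : ℕ) → (f : Fin p → ℕ) → Dec (NonIncr p f)
nonIncr? zero f = yes _
nonIncr? (suc zero) f = yes _
nonIncr? (suc (suc p)) f = (f (suc zero) ≤? f zero) ×-dec nonIncr? (suc p) (λ i → f (suc i))

isΛ? : (n k : ℕ) → Decidable (IsΛ n k)
isΛ? n k A = allFin? n _ (λ i → rowOnes A i ≟ k) ×-dec allFin? n _ (λ j → colOnes A j ≟ k)

inC? : (n m : ℕ) → Decidable (InC n m)
inC? n m A = nonDecr? n (rowVal A) ×-dec nonDecr? m (colVal A)

inD? : (n m : ℕ) → Decidable (InD n m)
inD? n m A = nonIncr? n (rowVal A) ×-dec nonIncr? m (colVal A)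

γ : ℕ → ℕ → ℕ
γ n k = length (filter (λ A → inC? n n A ×-dec isΛ? n k A) (allMatrices n n))

δ : ℕ → ℕ → ℕ
δ n k = length (filter (λ A → inD? n n A ×-dec isΛ? n k A) (allMatrices n n))

{-# OPTIONS --safe #-}
-- The witness is n = 5, k = 2, where γ(5,2) = 5 and δ(5,2) = 3.  The 2^25 binary 5×5 matrices
-- are too many to enumerate, but a matrix in Γ or Δ is a monotone sequence of rows with k ones
-- each.  So the count is computed row by row, extending a partial matrix only by rows with k ones
-- that respect the order on row values; no counted matrix is lost by this pruning.
module Submission where

open import Defs
open import Data.Nat using (ℕ; _≤_)
open import Data.Product using (Σ; _×_)
open import Relation.Binary.PropositionalEquality using (_≢_)

open import Level using (0ℓ)
open import Data.Bool using (Bool; true; false; if_then_else_)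
open import Data.Fin using (Fin; zero; suc; toℕ)
open import Data.List using (List; []; _∷_; _++_; map; length; filter; concatMap)
open import Data.List.Properties using (length-++; filter-++; filter-none; filter-≐; map-cong)
import Data.List.Relation.Unary.All as All
open import Data.Maybe using (Maybe; just; nothing)
open import Data.Nat using (zero; suc; _+_; _*_; _∸_; _^_; _≥_; _≤?_; _≟_; z≤n; s≤s)
open import Data.Nat.ListAction using (sum)
open import Data.Product using (_,_; proj₁; proj₂)
open import Data.Unit using (⊤; tt)
open import Data.Vec.Functional using () renaming (_∷_ to _∷ᵛ_)
open import Function using (_∘_; _on_)
open import Relation.Binary using (Rel; _Respects_)
import Relation.Binary as B
open import Relation.Nullary using (yes; no; does; _×-dec_)
open import Relation.Unary using (Pred; Decidable)
open import Relation.Binary.PropositionalEquality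
  using (_≡_; _≗_; refl; sym; trans; cong; cong₂; subst₂; module ≡-Reasoning)

length-filter-map : ∀ {A C : Set} {P : Pred C 0ℓ} (P? : Decidable P) (g : A → C) (l : List A) →
                    length (filter P? (map g l)) ≡ length (filter (P? ∘ g) l)
length-filter-map P? g []      = refl
length-filter-map P? g (x ∷ l) with P? (g x)
... | yes _ = cong suc (length-filter-map P? g l)
... | no  _ = length-filter-map P? g l

length-filter-concatMap : ∀ {A C : Set} {P : Pred C 0ℓ} (P? : Decidable P) (f : A → List C) (l : List A) →
                          length (filter P? (concatMap f l)) ≡ sum (map (λ x → length (filter P? (f x))) l)
length-filter-concatMap P? f []      = refl
length-filter-concatMap P? f (x ∷ l) = begin
  length (filter P? (f x ++ concatMap f l))              ≡⟨ cong length (filter-++ P? (f x) (concatMap f l)) ⟩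
  length (filter P? (f x) ++ filter P? (concatMap f l))  ≡⟨ length-++ (filter P? (f x)) ⟩
  length (filter P? (f x)) + length (filter P? (concatMap f l))
    ≡⟨ cong (length (filter P? (f x)) +_) (length-filter-concatMap P? f l) ⟩
  length (filter P? (f x)) + sum (map (λ y → length (filter P? (f y))) l) ∎
  where open ≡-Reasoning

length-filter-allFuns-suc : ∀ {A : Set} (xs : List A) (p : ℕ)
                            {P : Pred (Fin (suc p) → A) 0ℓ} (P? : Decidable P) → P Respects _≗_ →
                            length (filter P? (allFuns xs (suc p)))
                              ≡ sum (map (λ x → length (filter (P? ∘ (x ∷ᵛ_)) (allFuns xs p))) xs)
length-filter-allFuns-suc {A} xs p P? resp =
  trans (length-filter-concatMap P? _ xs)
        (cong sum (map-cong (λ x → first-value x _ (λ F → λ { zero → refl ; (suc i) → refl })) xs))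
  where
  -- allFuns prepends x with its own pattern lambda, which agrees with x ∷ᵛ_ only pointwise.
  first-value : ∀ x (g : (Fin p → A) → Fin (suc p) → A) → (∀ F → g F ≗ x ∷ᵛ F) →
                length (filter P? (map g (allFuns xs p))) ≡ length (filter (P? ∘ (x ∷ᵛ_)) (allFuns xs p))
  first-value x g g≗∷ = trans (length-filter-map P? g (allFuns xs p))
    (cong length (filter-≐ (P? ∘ g) (P? ∘ (x ∷ᵛ_))
      ((λ {F} → resp (g≗∷ F)) , (λ {F} → resp (sym ∘ g≗∷ F))) (allFuns xs p)))

module _ {A : Set} (Q : Pred A 0ℓ) (_∼_ : Rel A 0ℓ) where

  Admissible : Maybe A → A → Set
  Admissible nothing  x = Q x
  Admissible (just y) x = y ∼ x × Q x

  Chain : Maybe A → (p : ℕ) → Pred (Fin p → A) 0ℓ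
  Chain prev zero    F = ⊤
  Chain prev (suc p) F = Admissible prev (F zero) × Chain (just (F zero)) p (F ∘ suc)

module PrunedCount {A : Set} (xs : List A) {Q : Pred A 0ℓ} (Q? : Decidable Q)
                   {_∼_ : Rel A 0ℓ} (_∼?_ : B.Decidable _∼_) where

  admissible? : ∀ prev → Decidable (Admissible Q _∼_ prev)
  admissible? nothing  x = Q? x
  admissible? (just y) x = (y ∼? x) ×-dec Q? x

  prunedCount : (p : ℕ) {P : Pred (Fin p → A) 0ℓ} → Decidable P → Maybe A → ℕ
  prunedCount zero    P? prev = length (filter P? (allFuns xs zero))
  prunedCount (suc p) P? prev =
    sum (map (λ x → if does (admissible? prev x) then prunedCount p (P? ∘ (x ∷ᵛ_)) (just x) else 0) xs)

  length-filter-allFuns≡prunedCount :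
    ∀ p {P : Pred (Fin p → A) 0ℓ} (P? : Decidable P) prev → P Respects _≗_ →
    (∀ F → P F → Chain Q _∼_ prev p F) →
    length (filter P? (allFuns xs p)) ≡ prunedCount p P? prev
  length-filter-allFuns≡prunedCount zero    P? prev resp chain = refl
  length-filter-allFuns≡prunedCount (suc p) P? prev resp chain =
    trans (length-filter-allFuns-suc xs p P? resp) (cong sum (map-cong branch xs))
    where
    branch : ∀ x → length (filter (P? ∘ (x ∷ᵛ_)) (allFuns xs p)) ≡
             (if does (admissible? prev x) then prunedCount p (P? ∘ (x ∷ᵛ_)) (just x) else 0)
    branch x with admissible? prev x
    ... | yes _ = length-filter-allFuns≡prunedCount p (P? ∘ (x ∷ᵛ_)) (just x)
                    (λ F≗G → resp λ { zero → refl ; (suc i) → F≗G i })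
                    (λ F → proj₂ ∘ chain (x ∷ᵛ F))
    ... | no ¬adm = cong length (filter-none (P? ∘ (x ∷ᵛ_))
                      (All.universal (λ F → ¬adm ∘ proj₁ ∘ chain (x ∷ᵛ F)) (allFuns xs p)))

module _ {A : Set} {Q : Pred A 0ℓ} (f : A → ℕ) where

  nonDecr⇒Chain : ∀ {p} (F : Fin p → A) → (∀ i → Q (F i)) → NonDecr p (f ∘ F) →
                  Chain Q (_≤_ on f) nothing p F
  nonDecr⇒Chain {zero}        F q _       = tt
  nonDecr⇒Chain {suc zero}    F q _       = q zero , tt
  nonDecr⇒Chain {suc (suc p)} F q (≤₁ , s) = q zero , after (F zero) (F ∘ suc) ≤₁ (q ∘ suc) s
    where
    after : ∀ {p} y (F : Fin (suc p) → A) → f y ≤ f (F zero) → (∀ i → Q (F i)) → NonDecr (suc p) (f ∘ F) →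
            Chain Q (_≤_ on f) (just y) (suc p) F
    after {zero}  y F y≤ q _        = (y≤ , q zero) , tt
    after {suc p} y F y≤ q (≤₁ , s) = (y≤ , q zero) , after (F zero) (F ∘ suc) ≤₁ (q ∘ suc) s

  nonIncr⇒Chain : ∀ {p} (F : Fin p → A) → (∀ i → Q (F i)) → NonIncr p (f ∘ F) →
                  Chain Q (_≥_ on f) nothing p F
  nonIncr⇒Chain {zero}        F q _       = tt
  nonIncr⇒Chain {suc zero}    F q _       = q zero , tt
  nonIncr⇒Chain {suc (suc p)} F q (≥₁ , s) = q zero , after (F zero) (F ∘ suc) ≥₁ (q ∘ suc) s
    where
    after : ∀ {p} y (F : Fin (suc p) → A) → f y ≥ f (F zero) → (∀ i → Q (F i)) → NonIncr (suc p) (f ∘ F) →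
            Chain Q (_≥_ on f) (just y) (suc p) F
    after {zero}  y F y≥ q _        = (y≥ , q zero) , tt
    after {suc p} y F y≥ q (≥₁ , s) = (y≥ , q zero) , after (F zero) (F ∘ suc) ≥₁ (q ∘ suc) s

sumFin-cong : ∀ n {f g : Fin n → ℕ} → f ≗ g → sumFin n f ≡ sumFin n g
sumFin-cong zero    f≗g = refl
sumFin-cong (suc n) f≗g = cong₂ _+_ (f≗g zero) (sumFin-cong n (f≗g ∘ suc))

nonDecr-resp : ∀ p → NonDecr p Respects _≗_
nonDecr-resp zero          f≗g _       = tt
nonDecr-resp (suc zero)    f≗g _       = tt
nonDecr-resp (suc (suc p)) f≗g (≤₁ , s) =
  subst₂ _≤_ (f≗g zero) (f≗g (suc zero)) ≤₁ , nonDecr-resp (suc p) (f≗g ∘ suc) s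

nonIncr-resp : ∀ p → NonIncr p Respects _≗_
nonIncr-resp zero          f≗g _       = tt
nonIncr-resp (suc zero)    f≗g _       = tt
nonIncr-resp (suc (suc p)) f≗g (≥₁ , s) =
  subst₂ _≥_ (f≗g zero) (f≗g (suc zero)) ≥₁ , nonIncr-resp (suc p) (f≗g ∘ suc) s

Row : ℕ → Set
Row m = Fin m → Bool

value : ∀ {m} → Row m → ℕ
value {m} r = sumFin m (λ j → bit (r j) * 2 ^ (m ∸ suc (toℕ j)))

ones : ∀ {m} → Row m → ℕ
ones {m} r = sumFin m (λ j → bit (r j))

module _ {n m : ℕ} {A B : Matrix n m} (A≗B : A ≗ B) where

  rowVal-cong : rowVal A ≗ rowVal B
  rowVal-cong = cong value ∘ A≗B

  colVal-cong : colVal A ≗ colVal B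
  colVal-cong j = sumFin-cong n (λ i → cong (λ r → bit (r j) * 2 ^ (n ∸ suc (toℕ i))) (A≗B i))

  rowOnes-cong : rowOnes A ≗ rowOnes B
  rowOnes-cong = cong ones ∘ A≗B

  colOnes-cong : colOnes A ≗ colOnes B
  colOnes-cong j = sumFin-cong n (λ i → cong (λ r → bit (r j)) (A≗B i))

InC-resp : ∀ n m → InC n m Respects _≗_
InC-resp n m A≗B (rows , cols) = nonDecr-resp n (rowVal-cong A≗B) rows , nonDecr-resp m (colVal-cong A≗B) cols

InD-resp : ∀ n m → InD n m Respects _≗_
InD-resp n m A≗B (rows , cols) = nonIncr-resp n (rowVal-cong A≗B) rows , nonIncr-resp m (colVal-cong A≗B) cols

IsΛ-resp : ∀ n k → IsΛ n k Respects _≗_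
IsΛ-resp n k A≗B (rows , cols) =
  (λ i → trans (sym (rowOnes-cong A≗B i)) (rows i)) , (λ j → trans (sym (colOnes-cong A≗B j)) (cols j))

allRows : ∀ m → List (Row m)
allRows m = allFuns (true ∷ false ∷ []) m

module _ (n k : ℕ) where

  private
    ones≟k : Decidable (λ (r : Row n) → ones r ≡ k)
    ones≟k r = ones r ≟ k

  open PrunedCount (allRows n) ones≟k

  γ≡prunedCount : γ n k ≡
                  prunedCount (λ r s → value r ≤? value s) n (λ A → inC? n n A ×-dec isΛ? n k A) nothing
  γ≡prunedCount = length-filter-allFuns≡prunedCount _ n _ nothing
    (λ A≗B (inC , isΛ) → InC-resp n n A≗B inC , IsΛ-resp n k A≗B isΛ)
    (λ A ((rowsSorted , _) , (rowsOnes , _)) → nonDecr⇒Chain value A rowsOnes rowsSorted)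

  δ≡prunedCount : δ n k ≡
                  prunedCount (λ r s → value s ≤? value r) n (λ A → inD? n n A ×-dec isΛ? n k A) nothing
  δ≡prunedCount = length-filter-allFuns≡prunedCount _ n _ nothing
    (λ A≗B (inD , isΛ) → InD-resp n n A≗B inD , IsΛ-resp n k A≗B isΛ)
    (λ A ((rowsSorted , _) , (rowsOnes , _)) → nonIncr⇒Chain value A rowsOnes rowsSorted)

γ[5,2]≡5 : γ 5 2 ≡ 5
γ[5,2]≡5 = γ≡prunedCount 5 2

δ[5,2]≡3 : δ 5 2 ≡ 3
δ[5,2]≡3 = δ≡prunedCount 5 2

proposition1 : Σ ℕ (λ n → Σ ℕ (λ k → (2 ≤ n) × (k ≤ n) × (γ n k ≢ δ n k)))
proposition1 = 5 , 2 , s≤s (s≤s z≤n) , s≤s (s≤s z≤n) , γ≢δ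
  where
  5≢3 : 5 ≢ 3
  5≢3 ()

  γ≢δ : γ 5 2 ≢ δ 5 2
  γ≢δ γ≡δ = 5≢3 (trans (sym γ[5,2]≡5) (trans γ≡δ δ[5,2]≡3))
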